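{- For positive integers $n,q,p$ with $q > p$, if $n \geq 2^{2p}$ then $A_2(n;q,p) \geq n^{q/(2p)}$.
   Context: $K_{[N]}$ denotes the complete graph on $[N]$. A tight monotone path of length $n$ in $K_{[N]}$ is a sequence of vertices $v_1<\dots<v_{n+1}$ in $[N]$ together with its $n$ edges $\{v_i,v_{i+1}\}$; its color complexity under an edge-colouring is the number of distinct colours on its edges. $A_2(n;q,p)$ is the smallest integer $N$ such that every $q$-colouring of the edges of $K_{[N]}$ contains a tight monotone path of length $n$ with color complexity at most $p$. -}

module Defs where

open import Data.Nat using (ℕ; suc; _≤_)
open import Data.Fin using (Fin; inject₁; _<_)
open import Data.Fin.Properties using (_≟_)
open import Data.List using (List; length; tabulate; deduplicate)
open import Data.Product using (Σ; _×_)

-- An edge-colouring of K_[N] with q colours. Vertices [N] are modelled by Fin N.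
-- The colour of the edge {i,j} with i < j is c i j (values with i ≥ j are irrelevant).
Colouring : ℕ → ℕ → Set
Colouring N q = Fin N → Fin N → Fin q

record MonotonePath (N n : ℕ) : Set where
  field
    vtx : Fin (suc n) → Fin N
    increasing : (i : Fin n) → vtx (inject₁ i) < vtx (Fin.suc i)

open MonotonePath public

edgeColour : ∀ {N n q} → Colouring N q → MonotonePath N n → Fin n → Fin q
edgeColour c P i = c (vtx P (inject₁ i)) (vtx P (Fin.suc i))

colourComplexity : ∀ {N n q} → Colouring N q → MonotonePath N n → ℕ
colourComplexity {n = n} c P = length (deduplicate _≟_ (tabulate {n = n} (edgeColour c P)))

-- The defining property of A_2(n;q,p): every q-colouring of K_[N] contains a
-- tight monotone path of length n with colour complexity at most p.
A2Property : (n q p N : ℕ) → Set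
A2Property n q p N =
  (c : Colouring N q) → Σ (MonotonePath N n) (λ P → colourComplexity c P ≤ p)

{-# OPTIONS --safe #-}
-- Colour the edge {x, y} of K_[N], N ≤ m ^ q, by the most significant base-m
-- digit in which x and y differ. If all edges of a monotone path have colours
-- in a set S of digit positions, then the number formed by the digits of the
-- vertices in the positions of S strictly increases along the path and stays
-- below m ^ |S|, so the path is shorter than m ^ |S|. With m = ⌊n ^ (1/p)⌋ ≥ 2
-- the A₂ property therefore forces N > m ^ q, while n < (m + 1) ^ p ≤ m ^ (2p).
module Submission where

open import Defs
open import Data.Nat
  using (ℕ; zero; suc; _+_; _*_; _^_; _/_; _%_; _≤_; _<_; z≤n; s≤s; z<s; _≤?_; NonZero; >-nonZero)
open import Data.Nat.Properties
open import Data.Nat.DivMod using (m≡m%n+[m/n]*n; m%n<n; /-monoˡ-≤; m<n*o⇒m/o<n)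
open import Data.Fin as Fin using (Fin; toℕ; inject₁; fromℕ)
open import Data.Fin.Properties using (toℕ<n; toℕ-fromℕ)
open import Data.Fin.Subset using (Subset; inside; outside; ⁅_⁆; _∪_; ⋃; ∣_∣)
  renaming (_∈_ to _∈ₛ_)
open import Data.Fin.Subset.Properties using (∣⊥∣≡0; ∣⁅x⁆∣≡1; x∈⁅x⁆; p⊆p∪q; q⊆p∪q)
open import Data.List using (List; []; _∷_; map; length; tabulate; deduplicate)
open import Data.List.Membership.Propositional using (_∈_)
open import Data.List.Membership.Propositional.Properties using (∈-tabulate⁺; ∈-deduplicate⁺)
open import Data.List.Relation.Unary.Any using (here; there)
open import Data.Product using (∃-syntax; _×_; _,_)
open import Data.Vec using ([]; _∷_) renaming (here to hereᵥ; there to thereᵥ)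
open import Function using (_∘_)
open import Relation.Nullary using (yes; no)
open import Relation.Binary.PropositionalEquality
  using (_≡_; _≢_; refl; sym; trans; cong; subst; subst₂; module ≡-Reasoning)

∣p∪q∣≤∣p∣+∣q∣ : ∀ {k} (p q : Subset k) → ∣ p ∪ q ∣ ≤ ∣ p ∣ + ∣ q ∣
∣p∪q∣≤∣p∣+∣q∣ []            []            = z≤n
∣p∪q∣≤∣p∣+∣q∣ (inside  ∷ p) (outside ∷ q) = s≤s (∣p∪q∣≤∣p∣+∣q∣ p q)
∣p∪q∣≤∣p∣+∣q∣ (inside  ∷ p) (inside  ∷ q) =
  s≤s (≤-trans (∣p∪q∣≤∣p∣+∣q∣ p q) (+-monoʳ-≤ ∣ p ∣ (n≤1+n ∣ q ∣)))
∣p∪q∣≤∣p∣+∣q∣ (outside ∷ p) (inside  ∷ q) =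
  ≤-trans (s≤s (∣p∪q∣≤∣p∣+∣q∣ p q)) (≤-reflexive (sym (+-suc ∣ p ∣ ∣ q ∣)))
∣p∪q∣≤∣p∣+∣q∣ (outside ∷ p) (outside ∷ q) = ∣p∪q∣≤∣p∣+∣q∣ p q

fromList : ∀ {k} → List (Fin k) → Subset k
fromList xs = ⋃ (map ⁅_⁆ xs)

∣fromList∣≤length : ∀ {k} (xs : List (Fin k)) → ∣ fromList xs ∣ ≤ length xs
∣fromList∣≤length {k} []  = ≤-reflexive (∣⊥∣≡0 k)
∣fromList∣≤length (x ∷ xs) = ≤-trans (∣p∪q∣≤∣p∣+∣q∣ ⁅ x ⁆ (fromList xs))
  (+-mono-≤ (≤-reflexive (∣⁅x⁆∣≡1 x)) (∣fromList∣≤length xs))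

∈⇒∈ₛfromList : ∀ {k} {x : Fin k} {xs} → x ∈ xs → x ∈ₛ fromList xs
∈⇒∈ₛfromList (here refl)  = p⊆p∪q _ (x∈⁅x⁆ _)
∈⇒∈ₛfromList (there x∈xs) = q⊆p∪q ⁅ _ ⁆ _ (∈⇒∈ₛfromList x∈xs)

distinctEdgeColours : ∀ {N n q} → Colouring N q → MonotonePath N n → List (Fin q)
distinctEdgeColours c P = deduplicate Fin._≟_ (tabulate (edgeColour c P))

pathColours : ∀ {N n q} → Colouring N q → MonotonePath N n → Subset q
pathColours c P = fromList (distinctEdgeColours c P)

∣pathColours∣≤colourComplexity : ∀ {N n q} (c : Colouring N q) (P : MonotonePath N n) →
  ∣ pathColours c P ∣ ≤ colourComplexity c P
∣pathColours∣≤colourComplexity c P = ∣fromList∣≤length (distinctEdgeColours c P)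

edgeColour∈pathColours : ∀ {N n q} (c : Colouring N q) (P : MonotonePath N n) (i : Fin n) →
  edgeColour c P i ∈ₛ pathColours c P
edgeColour∈pathColours c P i = ∈⇒∈ₛfromList (∈-deduplicate⁺ Fin._≟_ (∈-tabulate⁺ i))

f0+toℕi≤fi : ∀ {n} (f : Fin (suc n) → ℕ) → (∀ i → f (inject₁ i) < f (Fin.suc i)) →
  ∀ i → f Fin.zero + toℕ i ≤ f i
f0+toℕi≤fi f increasing Fin.zero = ≤-reflexive (+-identityʳ _)
f0+toℕi≤fi {suc n} f increasing (Fin.suc i) = begin
  f Fin.zero + suc (toℕ i)      ≡⟨ +-suc (f Fin.zero) (toℕ i) ⟩
  suc (f Fin.zero) + toℕ i      ≤⟨ +-monoˡ-≤ (toℕ i) (increasing Fin.zero) ⟩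
  f (Fin.suc Fin.zero) + toℕ i  ≤⟨ f0+toℕi≤fi (f ∘ Fin.suc) (increasing ∘ Fin.suc) i ⟩
  f (Fin.suc i)                 ∎
  where open ≤-Reasoning

r+m*a<m*b : ∀ {m r a b} → r < m → a < b → r + m * a < m * b
r+m*a<m*b {m} {r} {a} {b} r<m a<b = begin-strict
  r + m * a  <⟨ +-monoˡ-< (m * a) r<m ⟩
  m + m * a  ≡⟨ sym (*-suc m a) ⟩
  m * suc a  ≤⟨ *-monoʳ-≤ m a<b ⟩
  m * b      ∎
  where open ≤-Reasoning

module Digits (m : ℕ) .{{_ : NonZero m}} where

  -- Digit positions are counted from the least significant one, and position q
  -- stands for all digits from q upwards, i.e. for x / m ^ q; for
  -- x, y < m ^ (1 + q) it is a genuine digit.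
  highestDifferingDigit : (q : ℕ) → ℕ → ℕ → Fin (suc q)
  highestDifferingDigit zero    x y = Fin.zero
  highestDifferingDigit (suc q) x y with x / m ≟ y / m
  ... | yes _ = Fin.zero
  ... | no  _ = Fin.suc (highestDifferingDigit q (x / m) (y / m))

  keepDigits : ∀ {q} → Subset (suc q) → ℕ → ℕ
  keepDigits {zero}  (inside  ∷ []) x = x
  keepDigits {zero}  (outside ∷ []) x = 0
  keepDigits {suc q} (inside  ∷ S)  x = x % m + m * keepDigits S (x / m)
  keepDigits {suc q} (outside ∷ S)  x = keepDigits S (x / m)

  x<m^[1+q]⇒x/m<m^q : ∀ {q x} → x < m ^ suc q → x / m < m ^ q
  x<m^[1+q]⇒x/m<m^q {q} {x} x<m^[1+q] = m<n*o⇒m/o<n (subst (x <_) (*-comm m (m ^ q)) x<m^[1+q])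

  keepDigits< : ∀ {q} (S : Subset (suc q)) {x} → x < m ^ suc q → keepDigits S x < m ^ ∣ S ∣
  keepDigits< {zero}  (inside  ∷ []) x<m = x<m
  keepDigits< {zero}  (outside ∷ []) x<m = s≤s z≤n
  keepDigits< {suc q} (inside  ∷ S) {x} x<m^[2+q] =
    r+m*a<m*b (m%n<n x m) (keepDigits< S (x<m^[1+q]⇒x/m<m^q {suc q} x<m^[2+q]))
  keepDigits< {suc q} (outside ∷ S) x<m^[2+q] =
    keepDigits< S (x<m^[1+q]⇒x/m<m^q {suc q} x<m^[2+q])

  %-mono-<-sameQuotient : ∀ {x y} → x < y → x / m ≡ y / m → x % m < y % m
  %-mono-<-sameQuotient {x} {y} x<y x/m≡y/m = +-cancelʳ-< (y / m * m) (x % m) (y % m)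
    (subst₂ _<_ (trans (m≡m%n+[m/n]*n x m) (cong (λ d → x % m + d * m) x/m≡y/m))
                (m≡m%n+[m/n]*n y m) x<y)

  /-mono-<-distinct : ∀ {x y} → x < y → x / m ≢ y / m → x / m < y / m
  /-mono-<-distinct x<y = ≤∧≢⇒< (/-monoˡ-≤ m (<⇒≤ x<y))

  keepDigits-mono-< : ∀ {q} (S : Subset (suc q)) {x y} → x < y →
    highestDifferingDigit q x y ∈ₛ S → keepDigits S x < keepDigits S y
  keepDigits-mono-< {zero} (inside ∷ []) x<y hereᵥ = x<y
  keepDigits-mono-< {suc q} S {x} {y} x<y d∈S with x / m ≟ y / m
  keepDigits-mono-< {suc q} (inside ∷ S) {x} {y} x<y hereᵥ | yes x/m≡y/m
    rewrite x/m≡y/m = +-monoˡ-< (m * keepDigits S (y / m)) (%-mono-<-sameQuotient x<y x/m≡y/m)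
  keepDigits-mono-< {suc q} (inside ∷ S) {x} {y} x<y (thereᵥ d∈S) | no x/m≢y/m =
    ≤-trans (r+m*a<m*b (m%n<n x m) (keepDigits-mono-< S (/-mono-<-distinct x<y x/m≢y/m) d∈S))
            (m≤n+m _ (y % m))
  keepDigits-mono-< {suc q} (outside ∷ S) x<y (thereᵥ d∈S) | no x/m≢y/m =
    keepDigits-mono-< S (/-mono-<-distinct x<y x/m≢y/m) d∈S

  digitColouring : (N q : ℕ) → Colouring N (suc q)
  digitColouring N q u v = highestDifferingDigit q (toℕ u) (toℕ v)

  length<m^colourComplexity : ∀ {N n q} → N ≤ m ^ suc q → (P : MonotonePath N n) →
    n < m ^ colourComplexity (digitColouring N q) P
  length<m^colourComplexity {N} {n} {q} N≤m^q P = begin-strict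
    n                         ≡⟨ sym (toℕ-fromℕ n) ⟩
    toℕ (fromℕ n)             ≤⟨ m≤n+m _ (f Fin.zero) ⟩
    f Fin.zero + toℕ (fromℕ n) ≤⟨ f0+toℕi≤fi f f-increasing (fromℕ n) ⟩
    f (fromℕ n)               <⟨ keepDigits< S (≤-trans (toℕ<n (vtx P (fromℕ n))) N≤m^q) ⟩
    m ^ ∣ S ∣                 ≤⟨ ^-monoʳ-≤ m (∣pathColours∣≤colourComplexity c P) ⟩
    m ^ colourComplexity c P  ∎
    where
    open ≤-Reasoning
    c : Colouring N (suc q)
    c = digitColouring N q
    S : Subset (suc q)
    S = pathColours c P
    f : Fin (suc n) → ℕ
    f i = keepDigits S (toℕ (vtx P i))
    f-increasing : ∀ i → f (inject₁ i) < f (Fin.suc i)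
    f-increasing i = keepDigits-mono-< S (increasing P i) (edgeColour∈pathColours c P i)

open Digits using (digitColouring; length<m^colourComplexity)

A2Property⇒m^q<N : ∀ {n q p N} m .{{_ : NonZero m}} → m ^ p ≤ n →
  A2Property n (suc q) p N → m ^ suc q < N
A2Property⇒m^q<N {q = q} {N = N} m m^p≤n A2 = ≰⇒> λ N≤m^q →
  let (P , P-complexity≤p) = A2 (digitColouring m N q)
  in <⇒≱ (length<m^colourComplexity m N≤m^q P) (≤-trans (^-monoʳ-≤ m P-complexity≤p) m^p≤n)

integerRoot : ∀ k n → ∃[ m ] m ^ suc k ≤ n × n < suc m ^ suc k
integerRoot k zero = 0 , z≤n , m^n>0 1 (suc k)
integerRoot k (suc n) with integerRoot k n
... | m , lower , upper with suc m ^ suc k ≤? suc n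
...   | yes [1+m]^[1+k]≤1+n =
  suc m , [1+m]^[1+k]≤1+n , ≤-trans (s≤s upper) (^-monoˡ-< (suc k) (n<1+n (suc m)))
...   | no [1+m]^[1+k]≰1+n = m , m≤n⇒m≤1+n lower , ≰⇒> [1+m]^[1+k]≰1+n

2≤integerRoot : ∀ {k m n} → 2 ^ suc k ≤ n → n < suc m ^ suc k → 2 ≤ m
2≤integerRoot {k} 2^[1+k]≤n n<[1+m]^[1+k] = ≮⇒≥ λ m<2 →
  <⇒≱ n<[1+m]^[1+k] (≤-trans (^-monoˡ-≤ (suc k) m<2) 2^[1+k]≤n)

[1+m]^k≤m^[2k] : ∀ {m} k → 2 ≤ m → suc m ^ k ≤ m ^ (2 * k)
[1+m]^k≤m^[2k] {m} k 2≤m = begin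
  suc m ^ k        ≤⟨ ^-monoˡ-≤ k (m<m*n m m {{>-nonZero (<-trans z<s 2≤m)}} 2≤m) ⟩
  (m * m) ^ k      ≡⟨ cong (λ x → (m * x) ^ k) (sym (*-identityʳ m)) ⟩
  (m ^ 2) ^ k      ≡⟨ ^-*-assoc m 2 k ⟩
  m ^ (2 * k)      ∎
  where open ≤-Reasoning

[m^a]^b≡[m^b]^a : ∀ m a b → (m ^ a) ^ b ≡ (m ^ b) ^ a
[m^a]^b≡[m^b]^a m a b = begin
  (m ^ a) ^ b  ≡⟨ ^-*-assoc m a b ⟩
  m ^ (a * b)  ≡⟨ cong (m ^_) (*-comm a b) ⟩
  m ^ (b * a)  ≡⟨ sym (^-*-assoc m b a) ⟩
  (m ^ b) ^ a  ∎
  where open ≡-Reasoning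

mainTheorem6 : (n q p : ℕ) → 1 ≤ n → 1 ≤ q → 1 ≤ p → p < q → 2 ^ (2 * p) ≤ n →
    (N : ℕ) → A2Property n q p N → n ^ q ≤ N ^ (2 * p)
mainTheorem6 n (suc q) (suc p) _ _ _ _ 2^[2p]≤n N A2 with integerRoot p n
... | m , m^p≤n , n<[1+m]^p = begin
  n ^ suc q                  ≤⟨ ^-monoˡ-≤ (suc q) (<⇒≤ n<m^[2p]) ⟩
  (m ^ (2 * suc p)) ^ suc q  ≡⟨ [m^a]^b≡[m^b]^a m (2 * suc p) (suc q) ⟩
  (m ^ suc q) ^ (2 * suc p)  ≤⟨ ^-monoˡ-≤ (2 * suc p) (<⇒≤ (A2Property⇒m^q<N m m^p≤n A2)) ⟩
  N ^ (2 * suc p)            ∎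
  where
  open ≤-Reasoning
  2≤m : 2 ≤ m
  2≤m = 2≤integerRoot {p} (≤-trans (^-monoʳ-≤ 2 (m≤m+n (suc p) _)) 2^[2p]≤n) n<[1+m]^p
  instance
    m≢0 : NonZero m
    m≢0 = >-nonZero (<-trans z<s 2≤m)
  n<m^[2p] : n < m ^ (2 * suc p)
  n<m^[2p] = <-≤-trans n<[1+m]^p ([1+m]^k≤m^[2k] (suc p) 2≤m)
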